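{- Let $p\geq 1$ and $q\geq 0$ be integers. For every $n\geq 0$, the $(p,q)$-Tower of Hanoi with $n$ disks admits a solution (a sequence of $(p,q)$-moves from $(\Delta_n,\varnothing,\varnothing)$ to $(\varnothing,\varnothing,\Delta_n)$), there is exactly one solution of minimal length, and its length is $m_n$, where $(m_n)_{n\in\mathbb{Z}}$ is defined by $m_n=0$ for $n\leq 0$ and $m_n=m_{n-p}+m_{n-p-q}+1$ for $n>0$.
   Context: Disks $1,\dots,n$. For integers $a,b$, $\Delta_b^{a}$ is the set of disks $d$ with $a\leq d\leq b$ (so $\Delta_b^a=\Delta_b=\{1,\dots,b\}$ when $a\leq 1$, and $\varnothing$ when $a>b$); $\Delta_b=\varnothing$ for $b<1$. A state is an ordered triple $(A,B,C)$ of pairwise disjoint sets with union $\Delta_n$ (each peg stacked in decreasing order, top = minimum). A $(p,q)$-move: for some $k\in\Delta_n$ and two distinct pegs $X,Y$ with $X=\Delta_k^{k-p+1}X'$ and $Y=\Delta_{k-p}Y'$ (all disks of $X',Y'$ larger than $k$), and third peg $Z$ containing only disks larger than $k$, the move puts simultaneously all disks of $\Delta_k^{k-p+1-q}$ onto $Z$: $\Delta_k^{k-p+1}X'\sqcup \Delta_{k-p}Y'\sqcup Z\longrightarrow X'\sqcup \Delta_{k-p-q}Y'\sqcup \Delta_k^{k-p+1-q} Z$ (peg positions preserved). The $(p,q)$-Tower of Hanoi is the puzzle where only $(p,q)$-moves are allowed. -}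

module Defs where

open import Data.Nat using (ℕ; zero; suc; _+_; _∸_; _≤_; _<_; s≤s; z≤n)
open import Data.Nat.Properties
open import Data.Fin using (Fin; toℕ)
import Data.Fin as Fin
open import Data.Vec using (Vec; lookup; replicate)
open import Data.List using (List; []; _∷_; length)
open import Data.Product using (Σ; _×_; ∃-syntax)
open import Relation.Binary.PropositionalEquality using (_≡_; _≢_; refl; sym; cong₂)
open import Relation.Nullary using (¬_)

Peg : Set
Peg = Fin 3

pegA pegC : Peg
pegA = Fin.zero
pegC = Fin.suc (Fin.suc Fin.zero)

-- A state with n disks: for each disk, the peg it lies on.
-- Index i : Fin n stands for disk  toℕ i + 1  (disks are 1..n).
-- Since each peg is stacked in decreasing order, the assignment
-- disk ↦ peg determines the state (A,B,C).
State : ℕ → Set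
State n = Vec Peg n

disk : ∀ {n} → Fin n → ℕ
disk i = suc (toℕ i)

start goal : (n : ℕ) → State n
start n = replicate n pegA
goal n = replicate n pegC

-- For a disk d ≤ k:  d ∈ Δ_k^{k-p+1}  iff  k < d + p,
--                    d ∈ Δ_{k-p}      iff  d + p ≤ k,
--                    d ∈ Δ_k^{k-p+1-q} iff k < d + p + q.
-- Hypotheses: X ∩ Δ_k = Δ_k^{k-p+1}, Y ∩ Δ_k = Δ_{k-p} (hence Z ∩ Δ_k = ∅);
-- effect: exactly the disks of Δ_k^{k-p+1-q} are moved onto Z, all others stay.
IsMove : (p q : ℕ) {n : ℕ} → State n → State n → Set
IsMove p q {n} s t =
  ∃[ k ] ∃[ X ] ∃[ Y ] ∃[ Z ]
    ( (1 ≤ k) × (k ≤ n)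
    × (X ≢ Y) × (X ≢ Z) × (Y ≢ Z)
    × ((i : Fin n) → disk i ≤ k → k < disk i + p → lookup s i ≡ X)
    × ((i : Fin n) → disk i ≤ k → disk i + p ≤ k → lookup s i ≡ Y)
    × ((i : Fin n) → disk i ≤ k → k < disk i + p + q → lookup t i ≡ Z)
    × ((i : Fin n) → ¬ (disk i ≤ k × k < disk i + p + q) → lookup t i ≡ lookup s i) )

data MovesFrom (p q : ℕ) {n : ℕ} : State n → List (State n) → Set where
  done : ∀ {s} → MovesFrom p q s []
  step : ∀ {s t ts} → IsMove p q s t → MovesFrom p q t ts → MovesFrom p q s (t ∷ ts)

final : ∀ {n} → State n → List (State n) → State n
final s [] = s
final s (t ∷ ts) = final t ts

-- A solution of the (p,q)-Tower of Hanoi with n disks is given by the list of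
-- states after each move; its length (number of moves) is the length of the list.
IsSolution : (p q n : ℕ) → List (State n) → Set
IsSolution p q n ts = MovesFrom p q (start n) ts × final (start n) ts ≡ goal n

-- The sequence m_n (n ≥ 0; m_n = 0 for n ≤ 0):
--   m_0 = 0,  m_n = m_{n-p} + m_{n-p-q} + 1 for n > 0 (with negative indices giving 0,
--   which matches truncated subtraction ∸ since m_0 = 0).
-- Implemented with fuel; for p ≥ 1 fuel n suffices (see m-rec below).
mFuel : (p q : ℕ) → ℕ → ℕ → ℕ
mFuel p q zero n = zero
mFuel p q (suc f) zero = zero
mFuel p q (suc f) (suc n) = mFuel p q f (suc n ∸ p) + mFuel p q f (suc n ∸ p ∸ q) + 1

m : (p q : ℕ) → ℕ → ℕ
m p q n = mFuel p q n n

mFuel-stable : ∀ p q → 1 ≤ p → ∀ f g n → n ≤ f → n ≤ g → mFuel p q f n ≡ mFuel p q g n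
mFuel-stable p q hp zero g zero _ _ = sym (z g)
  where z : ∀ g → mFuel p q g zero ≡ zero
        z zero = refl
        z (suc g) = refl
mFuel-stable p q hp (suc f) zero zero _ _ = refl
mFuel-stable p q hp (suc f) (suc g) zero _ _ = refl
mFuel-stable p q hp (suc f) (suc g) (suc n) (s≤s nf) (s≤s ng) =
  cong₂ (λ a b → a + b + 1)
    (mFuel-stable p q hp f g (suc n ∸ p) (≤-trans (a p hp) nf) (≤-trans (a p hp) ng))
    (mFuel-stable p q hp f g (suc n ∸ p ∸ q) (≤-trans (m∸n≤m (suc n ∸ p) q) (≤-trans (a p hp) nf))
                                          (≤-trans (m∸n≤m (suc n ∸ p) q) (≤-trans (a p hp) ng)))
  where a : ∀ p → 1 ≤ p → suc n ∸ p ≤ n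
        a (suc p) _ = m∸n≤m n p

m-zero : ∀ p q → m p q 0 ≡ 0
m-zero p q = refl

m-rec : ∀ p q → 1 ≤ p → ∀ n → m p q (suc n) ≡ m p q (suc n ∸ p) + m p q (suc n ∸ p ∸ q) + 1
m-rec p q hp n =
  cong₂ (λ a b → a + b + 1)
    (mFuel-stable p q hp n (suc n ∸ p) (suc n ∸ p) (a p hp) ≤-refl)
    (mFuel-stable p q hp n (suc n ∸ p ∸ q) (suc n ∸ p ∸ q) (≤-trans (m∸n≤m (suc n ∸ p) q) (a p hp)) ≤-refl)
  where a : ∀ p → 1 ≤ p → suc n ∸ p ≤ n
        a (suc p) _ = m∸n≤m n p

{-# OPTIONS --safe #-}
module Submission where

-- Call a state a configuration (K; X, e, Y) if disks 1..e lie on Y and disks e+1..K on X, and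
-- say a path has level J if all its moves have parameter k ≤ J.  By induction on J: a path of
-- level J from (J; X, e, Y) to (J; X, e′, Y′) has at least |m_e - m_e′| moves, and if e or e′ is 0
-- a path of exactly m_c moves (c the other one) is unique.  For the step to B = J + 1, a path is
-- cut at its moves of parameter B; such a move leads from (B; X, B-p, Y) to (B; Z, B-p-q, Y), so
-- each of them costs one plus the level-J distances to these configurations, and disk B leaving
-- its peg and coming back needs two of them.  Between two B-towers this leaves room for exactly
-- one, with both level-J legs optimal: this is where m_B = m_{B-p} + 1 + m_{B-p-q} comes from,
-- and uniqueness at level J transfers to level B.  Gluing optimal legs gives a path of length m_n.

open import Defs
open import Data.Nat
  using (ℕ; zero; suc; _+_; _∸_; _≤_; _<_; _≥_; s≤s; z≤n; ∣_-_∣; _≤?_; NonZero; >-nonZero⁻¹)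
open import Data.Nat.Properties
open import Data.Nat.Induction using (<-rec)
open import Data.Fin using (Fin; fromℕ<)
open import Data.Fin.Patterns using (0F; 1F; 2F)
open import Data.Fin.Properties using (toℕ-fromℕ<; toℕ<n)
open import Data.Vec using (lookup; tabulate)
open import Data.Vec.Properties using (lookup∘tabulate; lookup-replicate)
open import Data.Vec.Relation.Binary.Pointwise.Extensional using (ext; Pointwise-≡⇒≡)
open import Data.List using (List; []; _∷_; length; _++_)
open import Data.Product using (Σ-syntax; _×_; _,_; proj₁; proj₂; map₂; ∃-syntax)
open import Data.Sum using (_⊎_; inj₁; inj₂)
open import Data.Bool using (if_then_else_)
open import Data.Empty using (⊥-elim)
open import Relation.Nullary using (¬_; yes; no; does)
open import Relation.Nullary.Decidable using (dec-true; dec-false)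
open import Relation.Binary.PropositionalEquality

m∸n<o⇒m<o+n : ∀ {k r d} → k ∸ r < d → k < d + r
m∸n<o⇒m<o+n {k} {r} {d} lt =
  ≤-<-trans (m≤n+m∸n k r) (subst (r + (k ∸ r) <_) (+-comm r d) (+-monoʳ-< r lt))

m<o+n⇒m∸n<o : ∀ {k r d} .{{_ : NonZero d}} → k < d + r → k ∸ r < d
m<o+n⇒m∸n<o {k} {r} {d} lt = m<n+o⇒m∸n<o k r (subst (k <_) (+-comm d r) lt)

m≤o∸n⇒m+n≤o′ : ∀ {d r k} .{{_ : NonZero d}} → d ≤ k ∸ r → d + r ≤ k
m≤o∸n⇒m+n≤o′ {d} {r} {k} le =
  m≤o∸n⇒m+n≤o d (<⇒≤ (m∸n≢0⇒n<m (>⇒≢ (≤-trans (>-nonZero⁻¹ d) le)))) le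

∣m-n+o∣≤∣m-n∣+o : ∀ x y d → ∣ x - (y + d) ∣ ≤ ∣ x - y ∣ + d
∣m-n+o∣≤∣m-n∣+o x y d =
  ≤-trans (∣-∣-triangle x y (y + d)) (≤-reflexive (cong (∣ x - y ∣ +_) (∣m-m+n∣≡n y d)))

∣m+[1+n]-o∣≤m+[1+∣n-o∣] : ∀ x y z → ∣ x + suc y - z ∣ ≤ x + suc ∣ y - z ∣
∣m+[1+n]-o∣≤m+[1+∣n-o∣] x y z = begin
  ∣ x + suc y - z ∣             ≤⟨ ∣-∣-triangle (x + suc y) y z ⟩
  ∣ x + suc y - y ∣ + ∣ y - z ∣ ≡⟨ cong (_+ ∣ y - z ∣) x+suc[y]-y ⟩
  suc x + ∣ y - z ∣             ≡⟨ sym (+-suc x ∣ y - z ∣) ⟩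
  x + suc ∣ y - z ∣             ∎
  where
  open ≤-Reasoning
  x+suc[y]-y : ∣ x + suc y - y ∣ ≡ suc x
  x+suc[y]-y = begin-equality
    ∣ x + suc y - y ∣ ≡⟨ cong ∣_- y ∣ (trans (+-suc x y) (+-comm (suc x) y)) ⟩
    ∣ y + suc x - y ∣ ≡⟨ ∣-∣-comm (y + suc x) y ⟩
    ∣ y - y + suc x ∣ ≡⟨ ∣m-m+n∣≡n y (suc x) ⟩
    suc x             ∎

∣-∣-two-detours : ∀ {x y z w L₁ L₂} → ∣ x - y ∣ ≤ L₁ → ∣ z - y ∣ + suc ∣ z - w ∣ ≤ L₂ →
                  2 + ∣ x - w ∣ ≤ L₁ + suc L₂
∣-∣-two-detours {x} {y} {z} {w} {L₁} {L₂} h₁ h₂ = begin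
  2 + ∣ x - w ∣                             ≤⟨ s≤s (s≤s (∣-∣-triangle x y w)) ⟩
  2 + (∣ x - y ∣ + ∣ y - w ∣)               ≤⟨ s≤s (s≤s (+-monoʳ-≤ ∣ x - y ∣ y-w≤)) ⟩
  2 + (∣ x - y ∣ + (∣ z - y ∣ + ∣ z - w ∣)) ≡⟨ sym (shuffle ∣ x - y ∣ ∣ z - y ∣ ∣ z - w ∣) ⟩
  ∣ x - y ∣ + suc (∣ z - y ∣ + suc ∣ z - w ∣) ≤⟨ +-mono-≤ h₁ (s≤s h₂) ⟩
  L₁ + suc L₂                                ∎
  where
  open ≤-Reasoning
  y-w≤ : ∣ y - w ∣ ≤ ∣ z - y ∣ + ∣ z - w ∣
  y-w≤ = ≤-trans (∣-∣-triangle y z w) (≤-reflexive (cong (_+ ∣ z - w ∣) (∣-∣-comm y z)))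
  shuffle : ∀ i j k → i + suc (j + suc k) ≡ 2 + (i + (j + k))
  shuffle i j k =
    trans (+-suc i (j + suc k)) (cong suc (trans (cong (i +_) (+-suc j k)) (+-suc i (j + k))))

+-tight : ∀ {x y x′ y′} → x ≤ x′ → y ≤ y′ → x′ + y′ ≡ x + y → x′ ≡ x × y′ ≡ y
+-tight {x} {y} {x′} {y′} x≤x′ y≤y′ eq =
    ≤-antisym (+-cancelʳ-≤ y′ x′ x (≤-trans (≤-reflexive eq) (+-monoʳ-≤ x y≤y′))) x≤x′
  , ≤-antisym (+-cancelˡ-≤ x′ y′ y (≤-trans (≤-reflexive eq) (+-monoˡ-≤ y x≤x′))) y≤y′

third : Peg → Peg → Peg
third 0F 1F = 2F
third 0F 2F = 1F
third 1F 0F = 2F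
third 1F 2F = 0F
third 2F 0F = 1F
third 2F 1F = 0F
third _  _  = 0F

third-fresh : ∀ {X Y} → X ≢ Y → third X Y ≢ X × third X Y ≢ Y
third-fresh {0F} {0F} X≢Y = ⊥-elim (X≢Y refl)
third-fresh {0F} {1F} _   = (λ ()) , (λ ())
third-fresh {0F} {2F} _   = (λ ()) , (λ ())
third-fresh {1F} {0F} _   = (λ ()) , (λ ())
third-fresh {1F} {1F} X≢Y = ⊥-elim (X≢Y refl)
third-fresh {1F} {2F} _   = (λ ()) , (λ ())
third-fresh {2F} {0F} _   = (λ ()) , (λ ())
third-fresh {2F} {1F} _   = (λ ()) , (λ ())
third-fresh {2F} {2F} X≢Y = ⊥-elim (X≢Y refl)

third-unique : ∀ {X Y Z} → X ≢ Y → Z ≢ X → Z ≢ Y → Z ≡ third X Y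
third-unique {0F} {0F}      X≢Y _   _   = ⊥-elim (X≢Y refl)
third-unique {1F} {1F}      X≢Y _   _   = ⊥-elim (X≢Y refl)
third-unique {2F} {2F}      X≢Y _   _   = ⊥-elim (X≢Y refl)
third-unique {0F} {1F} {0F} _   Z≢X _   = ⊥-elim (Z≢X refl)
third-unique {0F} {1F} {1F} _   _   Z≢Y = ⊥-elim (Z≢Y refl)
third-unique {0F} {1F} {2F} _   _   _   = refl
third-unique {0F} {2F} {0F} _   Z≢X _   = ⊥-elim (Z≢X refl)
third-unique {0F} {2F} {1F} _   _   _   = refl
third-unique {0F} {2F} {2F} _   _   Z≢Y = ⊥-elim (Z≢Y refl)
third-unique {1F} {0F} {0F} _   _   Z≢Y = ⊥-elim (Z≢Y refl)
third-unique {1F} {0F} {1F} _   Z≢X _   = ⊥-elim (Z≢X refl)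
third-unique {1F} {0F} {2F} _   _   _   = refl
third-unique {1F} {2F} {0F} _   _   _   = refl
third-unique {1F} {2F} {1F} _   Z≢X _   = ⊥-elim (Z≢X refl)
third-unique {1F} {2F} {2F} _   _   Z≢Y = ⊥-elim (Z≢Y refl)
third-unique {2F} {0F} {0F} _   _   Z≢Y = ⊥-elim (Z≢Y refl)
third-unique {2F} {0F} {1F} _   _   _   = refl
third-unique {2F} {0F} {2F} _   Z≢X _   = ⊥-elim (Z≢X refl)
third-unique {2F} {1F} {0F} _   _   _   = refl
third-unique {2F} {1F} {1F} _   _   Z≢Y = ⊥-elim (Z≢Y refl)
third-unique {2F} {1F} {2F} _   Z≢X _   = ⊥-elim (Z≢X refl)

module Hanoi (p q : ℕ) (p≥1 : p ≥ 1) (n : ℕ) where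

  M : ℕ → ℕ
  M = m p q

  M-step : ∀ c → M (suc c) ≡ M (suc c ∸ p) + suc (M (suc c ∸ p ∸ q))
  M-step c = begin
    M (suc c)       ≡⟨ m-rec p q p≥1 c ⟩
    M a + M b + 1   ≡⟨ +-assoc (M a) (M b) 1 ⟩
    M a + (M b + 1) ≡⟨ cong (M a +_) (+-comm (M b) 1) ⟩
    M a + suc (M b) ∎
    where
    open ≡-Reasoning
    a = suc c ∸ p
    b = a ∸ q

  1+c∸p≤c : ∀ c → suc c ∸ p ≤ c
  1+c∸p≤c c = m≤n+o⇒m∸n≤o (suc c) p (+-monoˡ-≤ c p≥1)

  c∸p∸q≤c∸p : ∀ c → c ∸ p ∸ q ≤ c ∸ p
  c∸p∸q≤c∸p c = m∸n≤m (c ∸ p) q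

  m∸p∸q<o⇒m<o+p+q : ∀ {k d} → k ∸ p ∸ q < d → k < d + p + q
  m∸p∸q<o⇒m<o+p+q {k} {d} lt =
    subst (k <_) (sym (+-assoc d p q)) (m∸n<o⇒m<o+n (subst (_< d) (∸-+-assoc k p q) lt))

  m<o+p+q⇒m∸p∸q<o : ∀ {k d} .{{_ : NonZero d}} → k < d + p + q → k ∸ p ∸ q < d
  m<o+p+q⇒m∸p∸q<o {k} {d} lt =
    subst (_< d) (sym (∸-+-assoc k p q)) (m<o+n⇒m∸n<o (subst (k <_) (+-assoc d p q) lt))

  m≤o∸p∸q⇒m+p+q≤o : ∀ {d k} .{{_ : NonZero d}} → d ≤ k ∸ p ∸ q → d + p + q ≤ k
  m≤o∸p∸q⇒m+p+q≤o {d} {k} le =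
    subst (_≤ k) (sym (+-assoc d p q)) (m≤o∸n⇒m+n≤o′ (subst (d ≤_) (∸-+-assoc k p q) le))

  m+p+q≤o⇒m≤o∸p∸q : ∀ {d k} → d + p + q ≤ k → d ≤ k ∸ p ∸ q
  m+p+q≤o⇒m≤o∸p∸q {d} {k} le =
    subst (d ≤_) (sym (∸-+-assoc k p q)) (m+n≤o⇒m≤o∸n d (subst (_≤ k) (+-assoc d p q) le))

  Move : State n → State n → Set
  Move = IsMove p q

  move-k≤n : ∀ {s t} (mv : Move s t) → proj₁ mv ≤ n
  move-k≤n (_ , _ , _ , _ , _ , k≤n , _) = k≤n

  data Path (J : ℕ) : State n → State n → ℕ → Set where
    nil  : ∀ {s} → Path J s s 0
    cons : ∀ {s t u ℓ} (mv : Move s t) → proj₁ mv ≤ J → Path J t u ℓ → Path J s u (suc ℓ)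

  states : ∀ {J s t ℓ} → Path J s t ℓ → List (State n)
  states nil                  = []
  states (cons {t = t} _ _ π) = t ∷ states π

  _++ᴾ_ : ∀ {J s t u ℓ₁ ℓ₂} → Path J s t ℓ₁ → Path J t u ℓ₂ → Path J s u (ℓ₁ + ℓ₂)
  nil           ++ᴾ ρ = ρ
  cons mv k≤J π ++ᴾ ρ = cons mv k≤J (π ++ᴾ ρ)

  raise : ∀ {J K s t ℓ} → J ≤ K → Path J s t ℓ → Path K s t ℓ
  raise J≤K nil             = nil
  raise J≤K (cons mv k≤J π) = cons mv (≤-trans k≤J J≤K) (raise J≤K π)

  record Tower (c : ℕ) (Y : Peg) (s : State n) : Set where
    constructor tower
    field pegOf : ∀ i → disk i ≤ c → lookup s i ≡ Y
  open Tower

  record Config (K : ℕ) (X : Peg) (e : ℕ) (Y : Peg) (s : State n) : Set where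
    constructor config
    field
      below : Tower e Y s
      above : ∀ i → e < disk i → disk i ≤ K → lookup s i ≡ X
  open Config

  SameAbove : ℕ → State n → State n → Set
  SameAbove c s t = ∀ i → c < disk i → lookup s i ≡ lookup t i

  Tower-≤ : ∀ {J K X s} → J ≤ K → Tower K X s → Tower J X s
  Tower-≤ J≤K tw = tower λ i d≤J → pegOf tw i (≤-trans d≤J J≤K)

  Config-≤ : ∀ {J K X e Y s} → J ≤ K → Config K X e Y s → Config J X e Y s
  Config-≤ J≤K cs = config (below cs) λ i e<d d≤J → above cs i e<d (≤-trans d≤J J≤K)

  Tower⇒Config : ∀ {K X Y s} → Tower K X s → Config K X 0 Y s
  Tower⇒Config tw = config (tower λ i ()) λ i _ → pegOf tw i

  Config-unique : ∀ {K X e Y s s′} → Config K X e Y s → Config K X e Y s′ → SameAbove K s s′ → s ≡ s′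
  Config-unique {K} {X} {e} {Y} {s} {s′} cs cs′ same = Pointwise-≡⇒≡ (ext agree)
    where
    agree : ∀ i → lookup s i ≡ lookup s′ i
    agree i with disk i ≤? e | disk i ≤? K
    ... | yes d≤e | _       = trans (pegOf (below cs) i d≤e) (sym (pegOf (below cs′) i d≤e))
    ... | no d≰e  | yes d≤K = trans (above cs i (≰⇒> d≰e) d≤K) (sym (above cs′ i (≰⇒> d≰e) d≤K))
    ... | no _    | no d≰K  = same i (≰⇒> d≰K)

  frozen : ∀ {J s t ℓ} → Path J s t ℓ → SameAbove J s t
  frozen nil i J<d = refl
  frozen (cons (k , _ , _ , _ , _ , _ , _ , _ , _ , _ , _ , _ , unmoved) k≤J π) i J<d =
    trans (sym (unmoved i λ (d≤k , _) → <⇒≱ J<d (≤-trans d≤k k≤J))) (frozen π i J<d)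

  setBelow : ℕ → Peg → State n → State n
  setBelow e Y s = tabulate λ i → if does (disk i ≤? e) then Y else lookup s i

  setBelow-≤ : ∀ {e Y} s i → disk i ≤ e → lookup (setBelow e Y s) i ≡ Y
  setBelow-≤ {e} {Y} s i d≤e =
    trans (lookup∘tabulate _ i) (cong (if_then Y else lookup s i) (dec-true (disk i ≤? e) d≤e))

  setBelow-> : ∀ {e Y} s i → e < disk i → lookup (setBelow e Y s) i ≡ lookup s i
  setBelow-> {e} {Y} s i e<d =
    trans (lookup∘tabulate _ i) (cong (if_then Y else lookup s i) (dec-false (disk i ≤? e) (<⇒≱ e<d)))

  SameAbove-setBelow : ∀ {e Y} s → SameAbove e s (setBelow e Y s)
  SameAbove-setBelow s i e<d = sym (setBelow-> s i e<d)

  setBelow-Config : ∀ {K X e Y s} → Tower K X s → Config K X e Y (setBelow e Y s)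
  setBelow-Config {s = s} tw =
    config (tower (setBelow-≤ s)) λ i e<d d≤K → trans (setBelow-> s i e<d) (pegOf tw i d≤K)

  record Shape (c : ℕ) (w u : State n) : Set where
    constructor shape
    field
      {X Y Z} : Peg
      X≢Y    : X ≢ Y
      X≢Z    : X ≢ Z
      Y≢Z    : Y ≢ Z
      before : Config c X (c ∸ p) Y w
      after  : Config c Z (c ∸ p ∸ q) Y u
      fixed  : SameAbove c w u

  move⇒shape : ∀ {c w u} (mv : Move w u) → proj₁ mv ≡ c → Shape c w u
  move⇒shape {w = w} {u} (k , X , Y , Z , _ , _ , X≢Y , X≢Z , Y≢Z , onX , onY , onZ , unmoved) refl =
    shape X≢Y X≢Z Y≢Z (config (tower belowY) aboveX) (config (tower belowY′) aboveZ)
          λ i k<d → sym (unmoved i λ (d≤k , _) → <⇒≱ k<d d≤k)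
    where
    belowY : ∀ i → disk i ≤ k ∸ p → lookup w i ≡ Y
    belowY i d≤a = onY i (≤-trans d≤a (m∸n≤m k p)) (m≤o∸n⇒m+n≤o′ d≤a)
    aboveX : ∀ i → k ∸ p < disk i → disk i ≤ k → lookup w i ≡ X
    aboveX i a<d d≤k = onX i d≤k (m∸n<o⇒m<o+n a<d)
    belowY′ : ∀ i → disk i ≤ k ∸ p ∸ q → lookup u i ≡ Y
    belowY′ i d≤b =
      trans (unmoved i λ (_ , k<) → <⇒≱ k< d+p+q≤k) (onY i (≤-trans (m≤m+n _ p) d+p≤k) d+p≤k)
      where
      d+p+q≤k = m≤o∸p∸q⇒m+p+q≤o d≤b
      d+p≤k = ≤-trans (m≤m+n (disk i + p) q) d+p+q≤k
    aboveZ : ∀ i → k ∸ p ∸ q < disk i → disk i ≤ k → lookup u i ≡ Z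
    aboveZ i b<d d≤k = onZ i d≤k (m∸p∸q<o⇒m<o+p+q b<d)

  shape⇒move : ∀ {c w u} → 1 ≤ c → c ≤ n → Shape c w u → Path c w u 1
  shape⇒move {c} {w} {u} 1≤c c≤n (shape {X} {Y} {Z} X≢Y X≢Z Y≢Z before after fixed) =
    cons (c , X , Y , Z , 1≤c , c≤n , X≢Y , X≢Z , Y≢Z , onX , onY , onZ , unmoved) ≤-refl nil
    where
    onX : ∀ i → disk i ≤ c → c < disk i + p → lookup w i ≡ X
    onX i d≤c c<d+p = above before i (m<o+n⇒m∸n<o c<d+p) d≤c
    onY : ∀ i → disk i ≤ c → disk i + p ≤ c → lookup w i ≡ Y
    onY i _ d+p≤c = pegOf (below before) i (m+n≤o⇒m≤o∸n (disk i) d+p≤c)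
    onZ : ∀ i → disk i ≤ c → c < disk i + p + q → lookup u i ≡ Z
    onZ i d≤c c<d+p+q = above after i (m<o+p+q⇒m∸p∸q<o c<d+p+q) d≤c
    unmoved : ∀ i → ¬ (disk i ≤ c × c < disk i + p + q) → lookup u i ≡ lookup w i
    unmoved i moving with disk i ≤? c | disk i + p + q ≤? c
    ... | no d≰c  | _           = sym (fixed i (≰⇒> d≰c))
    ... | yes d≤c | no d+p+q≰c  = ⊥-elim (moving (d≤c , ≰⇒> d+p+q≰c))
    ... | yes _   | yes d+p+q≤c =
      trans (pegOf (below after) i d≤b) (sym (pegOf (below before) i (≤-trans d≤b (c∸p∸q≤c∸p c))))
      where d≤b = m+p+q≤o⇒m≤o∸p∸q d+p+q≤c

  CanonicalPath : ℕ → Set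
  CanonicalPath c = c ≤ n → ∀ {X Y s t} → X ≢ Y → Tower c X s → Tower c Y t → SameAbove c s t →
                    Path c s t (M c)

  canonical : ∀ c → CanonicalPath c
  canonical = <-rec CanonicalPath build
    where
    build : ∀ c → (∀ {c′} → c′ < c → CanonicalPath c′) → CanonicalPath c
    build zero _ _ {s = s} _ _ _ same =
      subst (λ t → Path 0 s t 0) (Pointwise-≡⇒≡ (ext λ i → same i (s≤s z≤n))) nil
    build (suc c) rec c≤n {X} {Y} {s} {t} X≢Y twX twY same =
      subst (Path (suc c) s t) (sym (M-step c))
            (raise a≤c π₁ ++ᴾ (shape⇒move (s≤s z≤n) c≤n sh ++ᴾ raise b≤c π₂))
      where
      a = suc c ∸ p
      b = a ∸ q
      R = third X Y
      R≢X : R ≢ X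
      R≢X = proj₁ (third-fresh X≢Y)
      R≢Y : R ≢ Y
      R≢Y = proj₂ (third-fresh X≢Y)
      a≤c : a ≤ suc c
      a≤c = ≤-trans (1+c∸p≤c c) (n≤1+n c)
      b≤c : b ≤ suc c
      b≤c = ≤-trans (c∸p∸q≤c∸p (suc c)) a≤c
      π₁ : Path a s (setBelow a R s) (M a)
      π₁ = rec (s≤s (1+c∸p≤c c)) (≤-trans a≤c c≤n) (≢-sym R≢X)
               (Tower-≤ a≤c twX) (tower (setBelow-≤ s)) (SameAbove-setBelow s)
      sh : Shape (suc c) (setBelow a R s) (setBelow b R t)
      sh = shape (≢-sym R≢X) X≢Y R≢Y (setBelow-Config twX) (setBelow-Config twY) λ i c<d →
             trans (setBelow-> s i (≤-<-trans a≤c c<d))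
                   (trans (same i c<d) (sym (setBelow-> t i (≤-<-trans b≤c c<d))))
      π₂ : Path b (setBelow b R t) t (M b)
      π₂ = rec (s≤s (≤-trans (c∸p∸q≤c∸p (suc c)) (1+c∸p≤c c))) (≤-trans b≤c c≤n) R≢Y
               (tower (setBelow-≤ t)) (Tower-≤ b≤c twY) (setBelow-> t)

  LowerBound : ℕ → Set
  LowerBound J = ∀ {s t ℓ X Y Y′ e e′} → Path J s t ℓ → X ≢ Y → X ≢ Y′ → e ≤ J → e′ ≤ J →
                 Config J X e Y s → Config J X e′ Y′ t → ∣ M e - M e′ ∣ ≤ ℓ

  BuildOrDismantle : ℕ → Peg → ℕ → Peg → State n → State n → Set
  BuildOrDismantle J X c Y s t = (Tower J X s × Config J X c Y t) ⊎ (Config J X c Y s × Tower J X t)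

  BuildOrDismantle-≤ : ∀ {J K X c Y s t} → J ≤ K → BuildOrDismantle K X c Y s t →
                       BuildOrDismantle J X c Y s t
  BuildOrDismantle-≤ J≤K (inj₁ (tw , ct)) = inj₁ (Tower-≤ J≤K tw , Config-≤ J≤K ct)
  BuildOrDismantle-≤ J≤K (inj₂ (cs , tw)) = inj₂ (Config-≤ J≤K cs , Tower-≤ J≤K tw)

  UniqueOptimal : ℕ → Set
  UniqueOptimal J = ∀ {s t ℓ ℓ′ X Y c} (π : Path J s t ℓ) (π′ : Path J s t ℓ′) → X ≢ Y → c ≤ J →
                    BuildOrDismantle J X c Y s t → ℓ ≡ M c → ℓ′ ≡ M c → states π ≡ states π′

  lowerBound-0 : LowerBound 0
  lowerBound-0 _ _ _ z≤n z≤n _ _ = z≤n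

  uniqueOptimal-0 : UniqueOptimal 0
  uniqueOptimal-0 nil          nil          _ _   _ _  _  = refl
  uniqueOptimal-0 (cons _ _ _) _            _ z≤n _ () _
  uniqueOptimal-0 nil          (cons _ _ _) _ z≤n _ _  ()

  module Step (J : ℕ) (B≤n : suc J ≤ n) (lowerBoundJ : LowerBound J) where

    B a b : ℕ
    B = suc J
    a = B ∸ p
    b = a ∸ q

    J≤B : J ≤ B
    J≤B = n≤1+n J

    a≤J : a ≤ J
    a≤J = 1+c∸p≤c J

    b≤J : b ≤ J
    b≤J = ≤-trans (c∸p∸q≤c∸p B) a≤J

    diskB : Fin n
    diskB = fromℕ< B≤n

    diskB≡B : disk diskB ≡ B
    diskB≡B = cong suc (toℕ-fromℕ< B≤n)

    J<diskB : J < disk diskB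
    J<diskB = ≤-reflexive (sym diskB≡B)

    pegB-Tower : ∀ {X s} → Tower B X s → lookup s diskB ≡ X
    pegB-Tower tw = pegOf tw diskB (≤-reflexive diskB≡B)

    pegB-Config : ∀ {X e Y s} → e ≤ J → Config B X e Y s → lookup s diskB ≡ X
    pegB-Config e≤J cs = above cs diskB (≤-<-trans e≤J J<diskB) (≤-reflexive diskB≡B)

    pegB-frozen : ∀ {s t ℓ} → Path J s t ℓ → lookup s diskB ≡ lookup t diskB
    pegB-frozen π = frozen π diskB J<diskB

    data Split : State n → State n → ℕ → Set where
      low  : ∀ {s t ℓ} → Path J s t ℓ → Split s t ℓ
      high : ∀ {s w u t ℓ₁ ℓ₂} → Path J s w ℓ₁ → Shape B w u → Split u t ℓ₂ → Split s t (ℓ₁ + suc ℓ₂)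

    splitStates : ∀ {s t ℓ} → Split s t ℓ → List (State n)
    splitStates (low π)              = states π
    splitStates (high {u = u} π _ σ) = states π ++ u ∷ splitStates σ

    prepend : ∀ {s t u ℓ} (mv : Move s t) → proj₁ mv ≤ J → Split t u ℓ → Split s u (suc ℓ)
    prepend mv k≤J (low π)       = low (cons mv k≤J π)
    prepend mv k≤J (high π sh σ) = high (cons mv k≤J π) sh σ

    states-prepend : ∀ {s t u ℓ} (mv : Move s t) (k≤J : proj₁ mv ≤ J) (σ : Split t u ℓ) →
                     splitStates (prepend {s} mv k≤J σ) ≡ t ∷ splitStates σ
    states-prepend mv k≤J (low π)       = refl
    states-prepend mv k≤J (high π sh σ) = refl

    split : ∀ {s t ℓ} → Path B s t ℓ → Split s t ℓ
    split nil = low nil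
    split (cons mv k≤B π) with proj₁ mv ≤? J
    ... | yes k≤J = prepend mv k≤J (split π)
    ... | no k≰J  = high nil (move⇒shape mv (≤-antisym k≤B (≰⇒> k≰J))) (split π)

    states-split : ∀ {s t ℓ} (π : Path B s t ℓ) → splitStates (split π) ≡ states π
    states-split nil = refl
    states-split (cons {s} mv k≤B π) with proj₁ mv ≤? J
    ... | yes k≤J = trans (states-prepend {s} mv k≤J (split π)) (cong (_ ∷_) (states-split π))
    ... | no _    = cong (_ ∷_) (states-split π)

    Staying : Peg → Peg → ℕ → ℕ → ℕ → Set
    Staying X W e e′ ℓ = X ≡ W × ∣ M e - M e′ ∣ ≤ ℓ

    -- A path through a move of parameter B first reaches (B; X, a, Y), then leaves (B; Z, b, Y);
    -- if disk B ends where it started, it must have moved a second time.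
    Crossing : Peg → Peg → ℕ → ℕ → ℕ → Set
    Crossing X W e e′ ℓ = ∣ M e - M a ∣ + suc ∣ M b - M e′ ∣ ≤ ℓ × (X ≡ W → 2 + ∣ M e - M e′ ∣ ≤ ℓ)

    staying : ∀ {s t ℓ X Y W Y′ e e′} → Path J s t ℓ → X ≢ Y → W ≢ Y′ → e ≤ J → e′ ≤ J →
              Config B X e Y s → Config B W e′ Y′ t → Staying X W e e′ ℓ
    staying π X≢Y W≢Y′ e≤J e′≤J cs ct
      with trans (sym (pegB-Config e≤J cs)) (trans (pegB-frozen π) (pegB-Config e′≤J ct))
    ... | refl = refl , lowerBoundJ π X≢Y W≢Y′ e≤J e′≤J (Config-≤ J≤B cs) (Config-≤ J≤B ct)

    splitBound : ∀ {s t ℓ X Y W Y′ e e′} → Split s t ℓ → X ≢ Y → W ≢ Y′ → e ≤ J → e′ ≤ J →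
                 Config B X e Y s → Config B W e′ Y′ t → Staying X W e e′ ℓ ⊎ Crossing X W e e′ ℓ
    crossing : ∀ {s w u t ℓ₁ ℓ₂ X Y W Y′ e e′} → Path J s w ℓ₁ → Shape B w u → Split u t ℓ₂ →
               X ≢ Y → W ≢ Y′ → e ≤ J → e′ ≤ J → Config B X e Y s → Config B W e′ Y′ t →
               Crossing X W e e′ (ℓ₁ + suc ℓ₂)

    splitBound (low π)       X≢Y W≢Y′ e≤J e′≤J cs ct = inj₁ (staying π X≢Y W≢Y′ e≤J e′≤J cs ct)
    splitBound (high π sh σ) X≢Y W≢Y′ e≤J e′≤J cs ct = inj₂ (crossing π sh σ X≢Y W≢Y′ e≤J e′≤J cs ct)

    crossing {ℓ₁ = ℓ₁} {ℓ₂} {W = W} {e = e} {e′} π (shape {X} {Y} {Z} X≢Y X≢Z Y≢Z before after _) σ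
             X≢Y₀ W≢Y′ e≤J e′≤J cs ct
      with trans (sym (pegB-Config e≤J cs)) (trans (pegB-frozen π) (pegB-Config a≤J before))
    ... | refl = continue (splitBound σ (≢-sym Y≢Z) W≢Y′ b≤J e′≤J after ct)
      where
      toA : ∣ M e - M a ∣ ≤ ℓ₁
      toA = lowerBoundJ π X≢Y₀ X≢Y e≤J a≤J (Config-≤ J≤B cs) (Config-≤ J≤B before)
      continue : Staying Z W b e′ ℓ₂ ⊎ Crossing Z W b e′ ℓ₂ → Crossing X W e e′ (ℓ₁ + suc ℓ₂)
      continue (inj₁ (Z≡W , fromB)) =
        +-mono-≤ toA (s≤s fromB) , λ X≡W → ⊥-elim (X≢Z (trans X≡W (sym Z≡W)))
      continue (inj₂ (again , _)) =
          +-mono-≤ toA (≤-trans (m≤n+m _ _) (≤-trans again (n≤1+n ℓ₂)))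
        , λ _ → ∣-∣-two-detours {M e} {M a} {M b} {M e′} toA again

    toTower : ∀ {ℓ X W e} → X ≢ W → Staying X W e 0 ℓ ⊎ Crossing X W e 0 ℓ → ∣ M e - M B ∣ ≤ ℓ
    toTower X≢W (inj₁ (X≡W , _))            = ⊥-elim (X≢W X≡W)
    toTower {ℓ} {e = e} _ (inj₂ (cross , _)) = begin
      ∣ M e - M B ∣                   ≡⟨ cong ∣ M e -_∣ (M-step J) ⟩
      ∣ M e - (M a + suc (M b)) ∣     ≤⟨ ∣m-n+o∣≤∣m-n∣+o (M e) (M a) (suc (M b)) ⟩
      ∣ M e - M a ∣ + suc (M b)       ≡⟨ cong (λ x → ∣ M e - M a ∣ + suc x) (sym (∣-∣-identityʳ (M b))) ⟩
      ∣ M e - M a ∣ + suc ∣ M b - 0 ∣ ≤⟨ cross ⟩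
      ℓ                               ∎
      where open ≤-Reasoning

    fromTower : ∀ {ℓ X W e′} → X ≢ W → Staying X W 0 e′ ℓ ⊎ Crossing X W 0 e′ ℓ → ∣ M B - M e′ ∣ ≤ ℓ
    fromTower X≢W (inj₁ (X≡W , _))             = ⊥-elim (X≢W X≡W)
    fromTower {ℓ} {e′ = e′} _ (inj₂ (cross , _)) = begin
      ∣ M B - M e′ ∣             ≡⟨ cong ∣_- M e′ ∣ (M-step J) ⟩
      ∣ M a + suc (M b) - M e′ ∣ ≤⟨ ∣m+[1+n]-o∣≤m+[1+∣n-o∣] (M a) (M b) (M e′) ⟩
      M a + suc ∣ M b - M e′ ∣   ≤⟨ cross ⟩
      ℓ                          ∎
      where open ≤-Reasoning

    lowerBound-step : LowerBound B
    lowerBound-step π X≢Y X≢Y′ e≤B e′≤B cs ct with m≤n⇒m<n∨m≡n e≤B | m≤n⇒m<n∨m≡n e′≤B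
    ... | inj₁ (s≤s e≤J) | inj₁ (s≤s e′≤J) with splitBound (split π) X≢Y X≢Y′ e≤J e′≤J cs ct
    ...   | inj₁ (_ , bound) = bound
    ...   | inj₂ (_ , twice) = ≤-trans (m≤n+m _ 2) (twice refl)
    lowerBound-step {e = e} π X≢Y X≢Y′ _ _ cs ct | inj₁ (s≤s e≤J) | inj₂ refl =
      toTower {e = e} X≢Y′
        (splitBound (split π) X≢Y (≢-sym X≢Y′) e≤J z≤n cs (Tower⇒Config (below ct)))
    lowerBound-step {e′ = e′} π X≢Y X≢Y′ _ _ cs ct | inj₂ refl | inj₁ (s≤s e′≤J) =
      fromTower {e′ = e′} (≢-sym X≢Y)
        (splitBound (split π) (≢-sym X≢Y) X≢Y′ z≤n e′≤J (Tower⇒Config (below cs)) ct)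
    lowerBound-step π _ _ _ _ _ _ | inj₂ refl | inj₂ refl = ≤-trans (≤-reflexive (∣n-n∣≡0 (M B))) z≤n

    short⇒low : ∀ {s t ℓ X Y Y′ e e′} (σ : Split s t ℓ) → X ≢ Y → X ≢ Y′ → e ≤ J → e′ ≤ J →
                Config B X e Y s → Config B X e′ Y′ t → ℓ ≤ suc ∣ M e - M e′ ∣ →
                Σ[ π ∈ Path J s t ℓ ] states π ≡ splitStates σ
    short⇒low (low π)       _   _    _   _    _  _  _     = π , refl
    short⇒low (high π sh σ) X≢Y X≢Y′ e≤J e′≤J cs ct short =
      ⊥-elim (<-irrefl refl (≤-trans (proj₂ (crossing π sh σ X≢Y X≢Y′ e≤J e′≤J cs ct) refl) short))

    optimal⇒low : ∀ {s t ℓ X Y c} (π : Path B s t ℓ) → X ≢ Y → c ≤ J → BuildOrDismantle B X c Y s t →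
                  ℓ ≡ M c → Σ[ π₀ ∈ Path J s t ℓ ] states π₀ ≡ states π
    optimal⇒low {c = c} π X≢Y c≤J (inj₁ (tw , ct)) refl =
      map₂ (λ eq → trans eq (states-split π))
        (short⇒low (split π) X≢Y X≢Y z≤n c≤J (Tower⇒Config tw) ct (n≤1+n (M c)))
    optimal⇒low {c = c} π X≢Y c≤J (inj₂ (cs , tw)) refl =
      map₂ (λ eq → trans eq (states-split π))
        (short⇒low (split π) X≢Y X≢Y c≤J z≤n cs (Tower⇒Config tw)
                   (≤-trans (≤-reflexive (sym (∣-∣-identityʳ (M c)))) (n≤1+n _)))

    build-cost : ∀ {s t ℓ X Y c} → Path J s t ℓ → X ≢ Y → c ≤ J → Tower B X s → Config B X c Y t →
                 M c ≤ ℓ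
    build-cost π X≢Y c≤J tw ct =
      lowerBoundJ π X≢Y X≢Y z≤n c≤J (Config-≤ J≤B (Tower⇒Config tw)) (Config-≤ J≤B ct)

    dismantle-cost : ∀ {s t ℓ X Y c} → Path J s t ℓ → X ≢ Y → c ≤ J → Config B X c Y s → Tower B X t →
                     M c ≤ ℓ
    dismantle-cost {c = c} π X≢Y c≤J cs tw = subst (_≤ _) (∣-∣-identityʳ (M c))
      (lowerBoundJ π X≢Y X≢Y c≤J z≤n (Config-≤ J≤B cs) (Config-≤ J≤B (Tower⇒Config tw)))

    record OptimalSplit (P Q : Peg) (s t : State n) (xs : List (State n)) : Set where
      field
        first   : Path J s (setBelow a (third P Q) s) (M a)
        second  : Path J (setBelow b (third P Q) t) t (M b)
        states≡ : xs ≡ states first ++ setBelow b (third P Q) t ∷ states second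
    open OptimalSplit

    assemble : ∀ {P Q s t w u ℓ₁ ℓ₂} (π : Path J s w ℓ₁) (ρ : Path J u t ℓ₂) →
               w ≡ setBelow a (third P Q) s → u ≡ setBelow b (third P Q) t → ℓ₁ ≡ M a → ℓ₂ ≡ M b →
               OptimalSplit P Q s t (states π ++ u ∷ states ρ)
    assemble π ρ refl refl refl refl = record { first = π ; second = ρ ; states≡ = refl }

    optimalSplit : ∀ {s t ℓ P Q} (σ : Split s t ℓ) → P ≢ Q → Tower B P s → Tower B Q t → ℓ ≡ M B →
                   OptimalSplit P Q s t (splitStates σ)
    optimalSplit (low π) P≢Q twP twQ _ =
      ⊥-elim (P≢Q (trans (sym (pegB-Tower twP)) (trans (pegB-frozen π) (pegB-Tower twQ))))
    optimalSplit {s} {t} {P = P} {Q} (high {w = w} {u} {ℓ₁ = ℓ₁} {ℓ₂} π (shape X≢Y _ Y≢Z before after _) σ)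
                 P≢Q twP twQ ℓ≡
      with trans (sym (pegB-Tower twP)) (trans (pegB-frozen π) (pegB-Config a≤J before))
    ... | refl with σ
    ...   | high ρ sh σ′ = ⊥-elim (<-irrefl refl (+-cancelˡ-≤ (M a) _ _ too-long))
      where
      again : suc (M b) ≤ ℓ₂
      again = ≤-trans (m≤n+m (suc (M b)) ∣ M b - M a ∣)
        (subst (λ x → ∣ M b - M a ∣ + suc x ≤ ℓ₂) (∣-∣-identityʳ (M b))
          (proj₁ (crossing ρ sh σ′ (≢-sym Y≢Z) (≢-sym P≢Q) b≤J z≤n after (Tower⇒Config twQ))))
      too-long : M a + suc (suc (M b)) ≤ M a + suc (M b)
      too-long = ≤-trans (+-mono-≤ (build-cost π X≢Y a≤J twP before) (s≤s again))
                         (≤-reflexive (trans ℓ≡ (M-step J)))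
    ...   | low ρ with trans (sym (pegB-Config b≤J after)) (trans (pegB-frozen ρ) (pegB-Tower twQ))
    ...     | refl with third-unique P≢Q (≢-sym X≢Y) Y≢Z
    ...       | refl = assemble π ρ w≡ u≡ (proj₁ tight) (suc-injective (proj₂ tight))
      where
      tight = +-tight (build-cost π X≢Y a≤J twP before)
                      (s≤s (dismantle-cost ρ (≢-sym Y≢Z) b≤J after twQ))
                      (trans ℓ≡ (M-step J))
      w≡ : w ≡ setBelow a (third P Q) s
      w≡ = Config-unique before (setBelow-Config twP) λ i B<d →
             trans (sym (frozen π i (≤-<-trans J≤B B<d)))
                   (SameAbove-setBelow s i (≤-<-trans (≤-trans a≤J J≤B) B<d))
      u≡ : u ≡ setBelow b (third P Q) t
      u≡ = Config-unique after (setBelow-Config twQ) λ i B<d →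
             trans (frozen ρ i (≤-<-trans J≤B B<d))
                   (SameAbove-setBelow t i (≤-<-trans (≤-trans b≤J J≤B) B<d))

    towerToTower-unique : UniqueOptimal J → ∀ {s t ℓ ℓ′ P Q} (π : Path B s t ℓ) (π′ : Path B s t ℓ′) →
                          P ≢ Q → Tower B P s → Tower B Q t → ℓ ≡ M B → ℓ′ ≡ M B → states π ≡ states π′
    towerToTower-unique uniqueJ {s} {t} {P = P} {Q} π π′ P≢Q twP twQ ℓ≡ ℓ′≡ = begin
      states π                                    ≡⟨ sym (states-split π) ⟩
      splitStates (split π)                       ≡⟨ states≡ O ⟩
      states (first O) ++ u ∷ states (second O)   ≡⟨ cong₂ (λ xs ys → xs ++ u ∷ ys) firsts seconds ⟩
      states (first O′) ++ u ∷ states (second O′) ≡⟨ sym (states≡ O′) ⟩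
      splitStates (split π′)                      ≡⟨ states-split π′ ⟩
      states π′                                   ∎
      where
      open ≡-Reasoning
      O = optimalSplit (split π) P≢Q twP twQ ℓ≡
      O′ = optimalSplit (split π′) P≢Q twP twQ ℓ′≡
      u = setBelow b (third P Q) t
      firsts : states (first O) ≡ states (first O′)
      firsts = uniqueJ (first O) (first O′) (≢-sym (proj₁ (third-fresh P≢Q))) a≤J
                 (inj₁ (Tower-≤ J≤B twP , Config-≤ J≤B (setBelow-Config twP))) refl refl
      seconds : states (second O) ≡ states (second O′)
      seconds = uniqueJ (second O) (second O′) (≢-sym (proj₂ (third-fresh P≢Q))) b≤J
                  (inj₂ (Config-≤ J≤B (setBelow-Config twQ) , Tower-≤ J≤B twQ)) refl refl

    uniqueOptimal-step : UniqueOptimal J → UniqueOptimal B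
    uniqueOptimal-step uniqueJ π π′ X≢Y c≤B bd ℓ≡ ℓ′≡ with m≤n⇒m<n∨m≡n c≤B
    ... | inj₁ (s≤s c≤J) = begin
      states π             ≡⟨ sym (proj₂ low₁) ⟩
      states (proj₁ low₁)  ≡⟨ uniqueJ (proj₁ low₁) (proj₁ low₂) X≢Y c≤J (BuildOrDismantle-≤ J≤B bd) ℓ≡ ℓ′≡ ⟩
      states (proj₁ low₂)  ≡⟨ proj₂ low₂ ⟩
      states π′            ∎
      where
      open ≡-Reasoning
      low₁ = optimal⇒low π X≢Y c≤J bd ℓ≡
      low₂ = optimal⇒low π′ X≢Y c≤J bd ℓ′≡
    ... | inj₂ refl with bd
    ...   | inj₁ (twX , ct) = towerToTower-unique uniqueJ π π′ X≢Y twX (below ct) ℓ≡ ℓ′≡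
    ...   | inj₂ (cs , twX) = towerToTower-unique uniqueJ π π′ (≢-sym X≢Y) (below cs) twX ℓ≡ ℓ′≡

  lowerBound : ∀ J → J ≤ n → LowerBound J
  lowerBound zero    _   = lowerBound-0
  lowerBound (suc J) B≤n = Step.lowerBound-step J B≤n (lowerBound J (<⇒≤ B≤n))

  uniqueOptimal : ∀ J → J ≤ n → UniqueOptimal J
  uniqueOptimal zero    _   = uniqueOptimal-0
  uniqueOptimal (suc J) B≤n =
    Step.uniqueOptimal-step J B≤n (lowerBound J (<⇒≤ B≤n)) (uniqueOptimal J (<⇒≤ B≤n))

  pegA≢pegC : pegA ≢ pegC
  pegA≢pegC ()

  start-Tower : Tower n pegA (start n)
  start-Tower = tower λ i _ → lookup-replicate i pegA

  goal-Config : Config n pegA n pegC (goal n)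
  goal-Config = config (tower λ i _ → lookup-replicate i pegC) λ i n<d d≤n → ⊥-elim (<⇒≱ n<d d≤n)

  optimal : Path n (start n) (goal n) (M n)
  optimal = canonical n ≤-refl pegA≢pegC start-Tower (below goal-Config)
              λ i n<d → ⊥-elim (<⇒≱ n<d (toℕ<n i))

  movesFrom : ∀ {J s t ℓ} (π : Path J s t ℓ) → MovesFrom p q s (states π)
  movesFrom nil           = done
  movesFrom (cons mv _ π) = step mv (movesFrom π)

  final-states : ∀ {J s t ℓ} (π : Path J s t ℓ) → final s (states π) ≡ t
  final-states nil          = refl
  final-states (cons _ _ π) = final-states π

  length-states : ∀ {J s t ℓ} (π : Path J s t ℓ) → length (states π) ≡ ℓ
  length-states nil          = refl
  length-states (cons _ _ π) = cong suc (length-states π)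

  fromMoves : ∀ {s t us} → MovesFrom p q s us → final s us ≡ t →
              Σ[ π ∈ Path n s t (length us) ] states π ≡ us
  fromMoves done                 refl = nil , refl
  fromMoves (step {s} {t} mv ms) fin  =
    cons mv (move-k≤n {s} {t} mv) (proj₁ rest) , cong (_ ∷_) (proj₂ rest)
    where rest = fromMoves ms fin

  solution-minimal : ∀ us → IsSolution p q n us → M n ≤ length us
  solution-minimal us (ms , fin) =
    lowerBound n ≤-refl (proj₁ (fromMoves ms fin)) pegA≢pegC pegA≢pegC z≤n ≤-refl
               (Tower⇒Config start-Tower) goal-Config

  solution-unique : ∀ us → IsSolution p q n us → length us ≡ M n → us ≡ states optimal
  solution-unique us (ms , fin) len≡ = trans (sym (proj₂ path))
    (uniqueOptimal n ≤-refl (proj₁ path) optimal pegA≢pegC ≤-refl (inj₁ (start-Tower , goal-Config))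
                   len≡ refl)
    where path = fromMoves ms fin

theorem3p2 : (p q : ℕ) → p ≥ 1 → (n : ℕ) →
    ∃[ ts ] ( IsSolution p q n ts
            × length ts ≡ m p q n
            × ((us : List (State n)) → IsSolution p q n us → length ts ≤ length us)
            × ((us : List (State n)) → IsSolution p q n us → length us ≡ length ts → us ≡ ts) )
theorem3p2 p q p≥1 n =
    states optimal
  , (movesFrom optimal , final-states optimal)
  , length-states optimal
  , (λ us sol → subst (_≤ length us) (sym (length-states optimal)) (solution-minimal us sol))
  , (λ us sol len≡ → solution-unique us sol (trans len≡ (length-states optimal)))
  where open Hanoi p q p≥1 n
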